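{- Let $\mathcal{C}\subseteq 2^{[n]}$ be a code of degree two. For any $i\in[n]$, the code $\mathcal{C}\setminus i := \{c\setminus\{i\} : c\in\mathcal{C}\}$ has degree at most two.
   Context: A code is a set system $\mathcal{C}\subseteq 2^{[n]}$. For disjoint $\sigma,\tau\subseteq[n]$, $(\sigma,\tau)$ is a receptive field (RF) relation of $\mathcal{C}$ if every codeword $c\in\mathcal{C}$ with $\sigma\subseteq c$ satisfies $c\cap\tau\ne\emptyset$. It is minimal if neither $(\sigma\setminus\{i\},\tau)$ for $i\in\sigma$ nor $(\sigma,\tau\setminus\{j\})$ for $j\in\tau$ is an RF relation. The degree of $(\sigma,\tau)$ is $|\sigma|+|\tau|$, and the degree of a code is the maximum degree of its minimal RF relations. -}

module Defs where

open import Data.Nat using (ℕ; _+_; _≤_)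
open import Data.Fin using (Fin)
open import Data.Fin.Subset using (Subset; _∈_; _∉_; _⊆_; Empty; Nonempty; _∩_; _-_; ∣_∣)
open import Data.Product using (Σ; ∃; _×_; _,_)
open import Relation.Binary.PropositionalEquality using (_≡_)
open import Relation.Nullary using (¬_)
open import Level using (0ℓ; suc)

Code : ℕ → Set₁
Code n = Subset n → Set

Disjoint : ∀ {n} → Subset n → Subset n → Set
Disjoint σ τ = Empty (σ ∩ τ)

IsRF : ∀ {n} → Code n → Subset n → Subset n → Set
IsRF 𝒞 σ τ = Disjoint σ τ × (∀ c → 𝒞 c → σ ⊆ c → Nonempty (c ∩ τ))

IsMinimalRF : ∀ {n} → Code n → Subset n → Subset n → Set
IsMinimalRF 𝒞 σ τ =
  IsRF 𝒞 σ τ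
  × (∀ i → i ∈ σ → ¬ IsRF 𝒞 (σ - i) τ)
  × (∀ j → j ∈ τ → ¬ IsRF 𝒞 σ (τ - j))

rfDegree : ∀ {n} → Subset n → Subset n → ℕ
rfDegree σ τ = ∣ σ ∣ + ∣ τ ∣

DegreeAtMost : ∀ {n} → ℕ → Code n → Set
DegreeAtMost d 𝒞 = ∀ σ τ → IsMinimalRF 𝒞 σ τ → rfDegree σ τ ≤ d

HasDegree : ∀ {n} → ℕ → Code n → Set
HasDegree d 𝒞 =
  DegreeAtMost d 𝒞 × (∃ λ σ → ∃ λ τ → IsMinimalRF 𝒞 σ τ × rfDegree σ τ ≡ d)

deleteNeuron : ∀ {n} → Code n → Fin n → Code n
deleteNeuron 𝒞 i c' = ∃ λ c → 𝒞 c × c' ≡ c - i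

-- Every codeword of 𝒞 ∖ i misses i. Hence a minimal RF relation (σ, τ) of 𝒞 ∖ i
-- never has i ∈ τ (dropping i from τ keeps it an RF relation), and if i ∈ σ the
-- relation holds vacuously, so minimality forces σ = {i} and τ = ∅, of degree 1.
-- If i ∉ σ ∪ τ, then (σ, τ) and its one-element shrinkings are RF relations of
-- 𝒞 ∖ i exactly when they are RF relations of 𝒞, so (σ, τ) is a minimal RF
-- relation of 𝒞 and its degree is bounded by that of 𝒞.
module Submission where

open import Defs
open import Data.Nat using (ℕ; _≤_; _+_; z≤n; s≤s)
open import Data.Nat.Properties using (+-identityʳ; ≤-trans; module ≤-Reasoning)
open import Data.Fin using (Fin)
open import Data.Fin.Properties using (_≟_)
open import Data.Fin.Subset using (Subset; _∈_; _∉_; _⊆_; Empty; _─_; _-_; ⁅_⁆; ∣_∣; inside; outside)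
open import Data.Fin.Subset.Properties
  using (_∈?_; ⊆-refl; p─q⊆p; x∈p∩q⁺; x∈p∩q⁻; x∈⁅x⁆; x∈p∧x≢y⇒x∈p-y; p⊆q⇒∣p∣≤∣q∣; ∣⁅x⁆∣≡1; Empty-unique; ∣⊥∣≡0)
open import Data.Vec.Base using (_∷_; here; there)
open import Data.Product using (_,_; proj₁)
open import Data.Empty using (⊥-elim)
open import Relation.Nullary using (¬_; yes; no)
open import Relation.Binary.PropositionalEquality using (_≡_; refl; sym; cong; subst)

private
  variable
    n : ℕ
    x : Fin n
    p q σ τ σ′ τ′ : Subset n

x∈p─q⇒x∉q : x ∈ p ─ q → x ∉ q
x∈p─q⇒x∉q {p = inside ∷ _} {q = outside ∷ _} here ()
x∈p─q⇒x∉q {p = _ ∷ _}      {q = _ ∷ _}       (there x∈p─q) (there x∈q) = x∈p─q⇒x∉q x∈p─q x∈q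

x∉p-x : ∀ (p : Subset n) x → x ∉ p - x
x∉p-x p x x∈p-x = x∈p─q⇒x∉q x∈p-x (x∈⁅x⁆ x)

p-x⊆p : ∀ (p : Subset n) x → p - x ⊆ p
p-x⊆p p x = p─q⊆p p ⁅ x ⁆

Empty⇒∣p∣≡0 : ∀ {n} {p : Subset n} → Empty p → ∣ p ∣ ≡ 0
Empty⇒∣p∣≡0 {n} p-empty rewrite Empty-unique p-empty = ∣⊥∣≡0 n

Disjoint-mono : σ′ ⊆ σ → τ′ ⊆ τ → Disjoint σ τ → Disjoint σ′ τ′
Disjoint-mono {σ′ = σ′} {τ′ = τ′} σ′⊆σ τ′⊆τ σ∩τ-empty (k , k∈σ′∩τ′) =
  let k∈σ′ , k∈τ′ = x∈p∩q⁻ σ′ τ′ k∈σ′∩τ′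
  in σ∩τ-empty (k , x∈p∩q⁺ (σ′⊆σ k∈σ′ , τ′⊆τ k∈τ′))

_Avoids_ : Code n → Fin n → Set
𝒟 Avoids i = ∀ c → 𝒟 c → i ∉ c

deleteNeuron-avoids : ∀ (𝒞 : Code n) i → deleteNeuron 𝒞 i Avoids i
deleteNeuron-avoids 𝒞 i _ (c , _ , refl) = x∉p-x c i

module _ {𝒟 : Code n} {i : Fin n} (𝒟-avoids-i : 𝒟 Avoids i) where

  IsRF-avoiding-∈σ : i ∈ σ → Disjoint σ τ → IsRF 𝒟 σ τ
  IsRF-avoiding-∈σ i∈σ σ∩τ-empty =
    σ∩τ-empty , λ c c∈𝒟 σ⊆c → ⊥-elim (𝒟-avoids-i c c∈𝒟 (σ⊆c i∈σ))

  IsRF-avoiding-removeτ : IsRF 𝒟 σ τ → IsRF 𝒟 σ (τ - i)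
  IsRF-avoiding-removeτ {σ = σ} {τ = τ} (σ∩τ-empty , hits) =
    Disjoint-mono ⊆-refl (p-x⊆p τ i) σ∩τ-empty , λ c c∈𝒟 σ⊆c →
      let k , k∈c∩τ = hits c c∈𝒟 σ⊆c
          k∈c , k∈τ = x∈p∩q⁻ c τ k∈c∩τ
          k≢i : ¬ k ≡ i
          k≢i k≡i = 𝒟-avoids-i c c∈𝒟 (subst (_∈ c) k≡i k∈c)
      in k , x∈p∩q⁺ (k∈c , x∈p∧x≢y⇒x∈p-y k∈τ k≢i)

  IsMinimalRF-avoiding⇒∉τ : IsMinimalRF 𝒟 σ τ → i ∉ τ
  IsMinimalRF-avoiding⇒∉τ (rf , _ , τ-minimal) i∈τ =
    τ-minimal i i∈τ (IsRF-avoiding-removeτ rf)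

  IsMinimalRF-avoiding-∈σ⇒rfDegree≤1 : IsMinimalRF 𝒟 σ τ → i ∈ σ → rfDegree σ τ ≤ 1
  IsMinimalRF-avoiding-∈σ⇒rfDegree≤1 {σ = σ} {τ = τ} ((σ∩τ-empty , _) , σ-minimal , τ-minimal) i∈σ =
    begin
      ∣ σ ∣ + ∣ τ ∣  ≡⟨ cong (∣ σ ∣ +_) (Empty⇒∣p∣≡0 τ-empty) ⟩
      ∣ σ ∣ + 0      ≡⟨ +-identityʳ ∣ σ ∣ ⟩
      ∣ σ ∣          ≤⟨ p⊆q⇒∣p∣≤∣q∣ σ⊆⁅i⁆ ⟩
      ∣ ⁅ i ⁆ ∣      ≡⟨ ∣⁅x⁆∣≡1 i ⟩
      1              ∎
    where
      open ≤-Reasoning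

      σ⊆⁅i⁆ : σ ⊆ ⁅ i ⁆
      σ⊆⁅i⁆ {j} j∈σ with j ≟ i
      ... | yes refl = x∈⁅x⁆ i
      ... | no j≢i   = ⊥-elim (σ-minimal j j∈σ (IsRF-avoiding-∈σ
              (x∈p∧x≢y⇒x∈p-y i∈σ (λ i≡j → j≢i (sym i≡j)))
              (Disjoint-mono (p-x⊆p σ j) ⊆-refl σ∩τ-empty)))

      τ-empty : Empty τ
      τ-empty (j , j∈τ) = τ-minimal j j∈τ
        (IsRF-avoiding-∈σ i∈σ (Disjoint-mono ⊆-refl (p-x⊆p τ j) σ∩τ-empty))

module _ (𝒞 : Code n) (i : Fin n) where

  IsRF-deleteNeuron⇒IsRF : i ∉ σ → IsRF (deleteNeuron 𝒞 i) σ τ → IsRF 𝒞 σ τ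
  IsRF-deleteNeuron⇒IsRF {σ = σ} {τ = τ} i∉σ (σ∩τ-empty , hits) = σ∩τ-empty , λ c c∈𝒞 σ⊆c →
    let σ⊆c-i : σ ⊆ c - i
        σ⊆c-i k∈σ = x∈p∧x≢y⇒x∈p-y (σ⊆c k∈σ) (λ k≡i → i∉σ (subst (_∈ σ) k≡i k∈σ))
        k , k∈c-i∩τ = hits (c - i) (c , c∈𝒞 , refl) σ⊆c-i
        k∈c-i , k∈τ = x∈p∩q⁻ (c - i) τ k∈c-i∩τ
    in k , x∈p∩q⁺ (p-x⊆p c i k∈c-i , k∈τ)

  IsRF⇒IsRF-deleteNeuron : i ∉ τ → IsRF 𝒞 σ τ → IsRF (deleteNeuron 𝒞 i) σ τ
  IsRF⇒IsRF-deleteNeuron {τ = τ} i∉τ (σ∩τ-empty , hits) = σ∩τ-empty , λ { _ (c , c∈𝒞 , refl) σ⊆c-i →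
    let k , k∈c∩τ = hits c c∈𝒞 (λ k∈σ → p-x⊆p c i (σ⊆c-i k∈σ))
        k∈c , k∈τ = x∈p∩q⁻ c τ k∈c∩τ
    in k , x∈p∩q⁺ (x∈p∧x≢y⇒x∈p-y k∈c (λ k≡i → i∉τ (subst (_∈ τ) k≡i k∈τ)) , k∈τ) }

  IsMinimalRF-deleteNeuron⇒IsMinimalRF :
    i ∉ σ → i ∉ τ → IsMinimalRF (deleteNeuron 𝒞 i) σ τ → IsMinimalRF 𝒞 σ τ
  IsMinimalRF-deleteNeuron⇒IsMinimalRF {τ = τ} i∉σ i∉τ (rf , σ-minimal , τ-minimal) =
      IsRF-deleteNeuron⇒IsRF i∉σ rf
    , (λ j j∈σ rf′ → σ-minimal j j∈σ (IsRF⇒IsRF-deleteNeuron i∉τ rf′))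
    , (λ j j∈τ rf′ → τ-minimal j j∈τ (IsRF⇒IsRF-deleteNeuron (λ i∈τ-j → i∉τ (p-x⊆p τ j i∈τ-j)) rf′))

DegreeAtMost-deleteNeuron : ∀ {d} (𝒞 : Code n) → 1 ≤ d → DegreeAtMost d 𝒞 → ∀ i →
  DegreeAtMost d (deleteNeuron 𝒞 i)
DegreeAtMost-deleteNeuron 𝒞 1≤d deg i σ τ minimal with i ∈? σ
... | yes i∈σ = ≤-trans (IsMinimalRF-avoiding-∈σ⇒rfDegree≤1 (deleteNeuron-avoids 𝒞 i) minimal i∈σ) 1≤d
... | no i∉σ  = deg σ τ (IsMinimalRF-deleteNeuron⇒IsMinimalRF 𝒞 i i∉σ i∉τ minimal)
  where i∉τ = IsMinimalRF-avoiding⇒∉τ (deleteNeuron-avoids 𝒞 i) minimal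

lemma6p1 : ∀ {n : ℕ} (𝒞 : Code n) → HasDegree 2 𝒞 → (i : Fin n) →
    DegreeAtMost 2 (deleteNeuron 𝒞 i)
lemma6p1 𝒞 hasDegree = DegreeAtMost-deleteNeuron 𝒞 (s≤s z≤n) (proj₁ hasDegree)
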